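{- Let $K$ be a field of characteristic $0$. The $2\times4$ multiplicity matrix \[M=\begin{pmatrix}2&1&0&0\\1&0&1&0\end{pmatrix}\] is not the multiplicity matrix of a polynomial: there exist no polynomial $f(x)\in K[x]$ and no sequence $\Lambda=(\lambda_1,\lambda_2)$ of distinct elements of $K$ with $M=M_f(\Lambda)$.
   Context: For a polynomial $f$ of degree $d$ and a sequence $\Lambda=(\lambda_1,\ldots,\lambda_m)$ of distinct elements of $K$, the multiplicity matrix $M_f(\Lambda)$ is the $m\times(d+1)$ matrix (rows $i\in\{1,\ldots,m\}$, columns $j\in\{0,\ldots,d\}$) whose $(i,j)$ entry is the multiplicity of $\lambda_i$ as a zero of the $j$th derivative $f^{(j)}(x)$ (which is $0$ if $f^{(j)}(\lambda_i)\neq0$). -}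

module Defs where

open import Level using (Level; _⊔_) renaming (suc to lsuc)
open import Algebra.Bundles using (CommutativeRing)
open import Data.Nat using (ℕ; zero; suc; _<_)
open import Data.List using (List; []; _∷_)
open import Data.Product using (Σ; ∃; _×_; _,_)
open import Relation.Nullary using (¬_)
open import Data.Fin using (Fin; zero; suc; toℕ)
open import Relation.Binary.PropositionalEquality using (_≡_)

record Field (c ℓ : Level) : Set (lsuc (c ⊔ ℓ)) where
  field
    commutativeRing : CommutativeRing c ℓ
  open CommutativeRing commutativeRing public
  field
    1≉0     : ¬ (1# ≈ 0#)
    inverse : ∀ x → ¬ (x ≈ 0#) → Σ Carrier λ y → x * y ≈ 1#

module FieldTheory {c ℓ : Level} (K : Field c ℓ) where
  open Field K

  ι : ℕ → Carrier
  ι zero    = 0#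
  ι (suc n) = 1# + ι n

  CharZero : Set ℓ
  CharZero = ∀ n → ¬ (ι (suc n) ≈ 0#)

  -- polynomials in K[x] as coefficient lists, constant term first
  Poly : Set c
  Poly = List Carrier

  coeff : Poly → ℕ → Carrier
  coeff []       _       = 0#
  coeff (a ∷ p)  zero    = a
  coeff (a ∷ p)  (suc i) = coeff p i

  -- equality of polynomials: equal coefficients (trailing zeros ignored)
  _≈ₚ_ : Poly → Poly → Set ℓ
  p ≈ₚ q = ∀ i → coeff p i ≈ coeff q i

  _+ₚ_ : Poly → Poly → Poly
  []      +ₚ q       = q
  (a ∷ p) +ₚ []      = a ∷ p
  (a ∷ p) +ₚ (b ∷ q) = (a + b) ∷ (p +ₚ q)

  scale : Carrier → Poly → Poly
  scale a []      = []
  scale a (b ∷ q) = (a * b) ∷ scale a q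

  _*ₚ_ : Poly → Poly → Poly
  []      *ₚ q = []
  (a ∷ p) *ₚ q = scale a q +ₚ (0# ∷ (p *ₚ q))

  _^ₚ_ : Poly → ℕ → Poly
  p ^ₚ zero    = 1# ∷ []
  p ^ₚ (suc n) = p *ₚ (p ^ₚ n)

  eval : Poly → Carrier → Carrier
  eval []      x = 0#
  eval (a ∷ p) x = a + x * eval p x

  X-_ : Carrier → Poly
  X- λ₀ = (- λ₀) ∷ 1# ∷ []

  derivFrom : ℕ → Poly → Poly
  derivFrom k []      = []
  derivFrom k (a ∷ p) = (ι k * a) ∷ derivFrom (suc k) p

  deriv : Poly → Poly
  deriv []      = []
  deriv (a ∷ p) = derivFrom 1 p

  deriv^ : ℕ → Poly → Poly
  deriv^ zero    f = f
  deriv^ (suc j) f = deriv (deriv^ j f)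

  HasDegree : Poly → ℕ → Set ℓ
  HasDegree f d = ¬ (coeff f d ≈ 0#) × (∀ i → d < i → coeff f i ≈ 0#)

  Multiplicity : Poly → Carrier → ℕ → Set (c ⊔ ℓ)
  Multiplicity g λ₀ m =
    Σ Poly λ q → (g ≈ₚ (((X- λ₀) ^ₚ m) *ₚ q)) × ¬ (eval q λ₀ ≈ 0#)

  Distinct : {m : ℕ} → (Fin m → Carrier) → Set ℓ
  Distinct Λ = ∀ i j → Λ i ≈ Λ j → i ≡ j

  IsMultMatrix : {m : ℕ} (d : ℕ) → Poly → (Fin m → Carrier)
               → (Fin m → Fin (suc d) → ℕ) → Set (c ⊔ ℓ)
  IsMultMatrix d f Λ M =
    HasDegree f d × (∀ i j → Multiplicity (deriv^ (toℕ j) f) (Λ i) (M i j))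

M₈ : Fin 2 → Fin 4 → ℕ
M₈ zero       zero                   = 2
M₈ zero       (suc zero)             = 1
M₈ zero       (suc (suc _))          = 0
M₈ (suc zero) zero                   = 1
M₈ (suc zero) (suc zero)             = 0
M₈ (suc zero) (suc (suc zero))       = 1
M₈ (suc zero) (suc (suc (suc _)))    = 0

{-# OPTIONS --safe #-}
-- Only four entries of M are needed: they say that f is a cubic with a double
-- root λ₁, and that λ₂ is a root of both f and f''.  Writing d = λ₂ − λ₁, Taylor
-- expansion at λ₁ gives 4 c₃ d³ = 2 f(λ₁) + 2 d f'(λ₁) + d² f''(λ₂) − 2 f(λ₂) = 0,
-- which is impossible in characteristic 0 since c₃ ≠ 0 and d ≠ 0.
module Submission where

open import Defs
open import Level using (Level)
open import Data.Fin using (Fin; toℕ) renaming (zero to fz; suc to fs)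
open import Data.Product using (Σ; _×_; _,_; proj₁)
open import Relation.Nullary using (¬_; yes; no)

open import Data.Nat using (ℕ; zero; suc; _<_; _≤_; s≤s; _≤?_)
open import Data.Nat.Properties using (≰⇒>)
open import Data.List using ([]; _∷_; applyUpTo)
open import Function using (_∘_)
open import Relation.Binary.PropositionalEquality as ≡ using (_≡_)
open import Data.Empty using (⊥)
import Algebra.Solver.Ring.NaturalCoefficients.Default as NaturalSolver

module _ {c ℓ : Level} (K : Field c ℓ) where
  open Field K
  open FieldTheory K
  open NaturalSolver commutativeSemiring using (solve; _:=_; _:+_; _:*_; con; Polynomial)
  open import Algebra.Properties.Group +-group using (\\-leftDividesˡ)

  x*y≈0⇒y≈0 : ∀ {x y} → ¬ (x ≈ 0#) → x * y ≈ 0# → y ≈ 0#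
  x*y≈0⇒y≈0 {x} {y} x≉0 xy≈0 with inverse x x≉0
  ... | x⁻¹ , xx⁻¹≈1 = begin
    y              ≈⟨ sym (*-identityˡ y) ⟩
    1# * y         ≈⟨ *-cong (sym (trans (*-comm x⁻¹ x) xx⁻¹≈1)) refl ⟩
    x⁻¹ * x * y    ≈⟨ *-assoc x⁻¹ x y ⟩
    x⁻¹ * (x * y)  ≈⟨ *-cong refl xy≈0 ⟩
    x⁻¹ * 0#       ≈⟨ zeroʳ x⁻¹ ⟩
    0#             ∎
    where open import Relation.Binary.Reasoning.Setoid setoid

  *-nonzero : ∀ {x y} → ¬ (x ≈ 0#) → ¬ (y ≈ 0#) → ¬ (x * y ≈ 0#)
  *-nonzero x≉0 y≉0 xy≈0 = y≉0 (x*y≈0⇒y≈0 x≉0 xy≈0)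

  eval-zeros : ∀ p x → (∀ i → coeff p i ≈ 0#) → eval p x ≈ 0#
  eval-zeros []      x p≈0 = refl
  eval-zeros (a ∷ p) x p≈0 =
    trans (+-cong (p≈0 0) (trans (*-cong refl (eval-zeros p x (p≈0 ∘ suc))) (zeroʳ x)))
          (+-identityˡ 0#)

  eval-cong : ∀ p q x → p ≈ₚ q → eval p x ≈ eval q x
  eval-cong []      q       x p≈q = sym (eval-zeros q x (sym ∘ p≈q))
  eval-cong (a ∷ p) []      x p≈q = eval-zeros (a ∷ p) x p≈q
  eval-cong (a ∷ p) (b ∷ q) x p≈q = +-cong (p≈q 0) (*-cong refl (eval-cong p q x (p≈q ∘ suc)))

  eval-congʳ : ∀ p {x y} → x ≈ y → eval p x ≈ eval p y
  eval-congʳ []      x≈y = refl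
  eval-congʳ (a ∷ p) x≈y = +-cong refl (*-cong x≈y (eval-congʳ p x≈y))

  eval-+ₚ : ∀ p q x → eval (p +ₚ q) x ≈ eval p x + eval q x
  eval-+ₚ []      q       x = sym (+-identityˡ _)
  eval-+ₚ (a ∷ p) []      x = sym (+-identityʳ _)
  eval-+ₚ (a ∷ p) (b ∷ q) x =
    trans (+-cong refl (*-cong refl (eval-+ₚ p q x)))
          (solve 5 (λ a b x u v → (a :+ b) :+ x :* (u :+ v) := (a :+ x :* u) :+ (b :+ x :* v))
                 refl a b x (eval p x) (eval q x))

  eval-scale : ∀ a q x → eval (scale a q) x ≈ a * eval q x
  eval-scale a []      x = sym (zeroʳ a)
  eval-scale a (b ∷ q) x =
    trans (+-cong refl (*-cong refl (eval-scale a q x)))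
          (solve 4 (λ a b x u → a :* b :+ x :* (a :* u) := a :* (b :+ x :* u)) refl a b x (eval q x))

  eval-*ₚ : ∀ p q x → eval (p *ₚ q) x ≈ eval p x * eval q x
  eval-*ₚ []      q x = sym (zeroˡ _)
  eval-*ₚ (a ∷ p) q x =
    trans (eval-+ₚ (scale a q) (0# ∷ (p *ₚ q)) x)
      (trans (+-cong (eval-scale a q x) (+-cong refl (*-cong refl (eval-*ₚ p q x))))
        (solve 4 (λ a x u v → a :* v :+ (con 0 :+ x :* (u :* v)) := (a :+ x :* u) :* v)
               refl a x (eval p x) (eval q x)))

  eval-X-self : ∀ λ₀ → eval (X- λ₀) λ₀ ≈ 0#
  eval-X-self λ₀ =
    trans (+-cong refl (solve 1 (λ x → x :* (con 1 :+ x :* con 0) := x) refl λ₀)) (-‿inverseˡ λ₀)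

  multiplicity-suc⇒root : ∀ g λ₀ m → Multiplicity g λ₀ (suc m) → eval g λ₀ ≈ 0#
  multiplicity-suc⇒root g λ₀ m (q , g≈ , _) = begin
    eval g λ₀                                                   ≈⟨ eval-cong g (((X- λ₀) ^ₚ suc m) *ₚ q) λ₀ g≈ ⟩
    eval (((X- λ₀) ^ₚ suc m) *ₚ q) λ₀                           ≈⟨ eval-*ₚ ((X- λ₀) ^ₚ suc m) q λ₀ ⟩
    eval ((X- λ₀) *ₚ ((X- λ₀) ^ₚ m)) λ₀ * eval q λ₀             ≈⟨ *-cong (eval-*ₚ (X- λ₀) ((X- λ₀) ^ₚ m) λ₀) refl ⟩
    eval (X- λ₀) λ₀ * eval ((X- λ₀) ^ₚ m) λ₀ * eval q λ₀        ≈⟨ *-cong (*-cong (eval-X-self λ₀) refl) refl ⟩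
    0# * eval ((X- λ₀) ^ₚ m) λ₀ * eval q λ₀                     ≈⟨ *-cong (zeroˡ _) refl ⟩
    0# * eval q λ₀                                              ≈⟨ zeroˡ _ ⟩
    0#                                                          ∎
    where open import Relation.Binary.Reasoning.Setoid setoid

  derivFrom-zeros : ∀ k q → (∀ i → coeff q i ≈ 0#) → ∀ i → coeff (derivFrom k q) i ≈ 0#
  derivFrom-zeros k []      q≈0 i       = refl
  derivFrom-zeros k (a ∷ q) q≈0 zero    = trans (*-cong refl (q≈0 0)) (zeroʳ _)
  derivFrom-zeros k (a ∷ q) q≈0 (suc i) = derivFrom-zeros (suc k) q (q≈0 ∘ suc) i

  derivFrom-cong : ∀ k p q → p ≈ₚ q → derivFrom k p ≈ₚ derivFrom k q
  derivFrom-cong k []      q       p≈q i       = sym (derivFrom-zeros k q (sym ∘ p≈q) i)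
  derivFrom-cong k (a ∷ p) []      p≈q i       = derivFrom-zeros k (a ∷ p) p≈q i
  derivFrom-cong k (a ∷ p) (b ∷ q) p≈q zero    = *-cong refl (p≈q 0)
  derivFrom-cong k (a ∷ p) (b ∷ q) p≈q (suc i) = derivFrom-cong (suc k) p q (p≈q ∘ suc) i

  deriv-cong : ∀ p q → p ≈ₚ q → deriv p ≈ₚ deriv q
  deriv-cong []      []      p≈q = λ _ → refl
  deriv-cong []      (b ∷ q) p≈q = derivFrom-cong 1 [] q (p≈q ∘ suc)
  deriv-cong (a ∷ p) []      p≈q = derivFrom-cong 1 p [] (p≈q ∘ suc)
  deriv-cong (a ∷ p) (b ∷ q) p≈q = derivFrom-cong 1 p q (p≈q ∘ suc)

  deriv^-cong : ∀ j p q → p ≈ₚ q → deriv^ j p ≈ₚ deriv^ j q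
  deriv^-cong zero    p q p≈q = p≈q
  deriv^-cong (suc j) p q p≈q = deriv-cong (deriv^ j p) (deriv^ j q) (deriv^-cong j p q p≈q)

  coeff-applyUpTo-< : ∀ h {n i} → i < n → coeff (applyUpTo h n) i ≡ h i
  coeff-applyUpTo-< h {suc n} {zero}  _         = ≡.refl
  coeff-applyUpTo-< h {suc n} {suc i} (s≤s i<n) = coeff-applyUpTo-< (h ∘ suc) i<n

  coeff-applyUpTo-≥ : ∀ h {n i} → n ≤ i → coeff (applyUpTo h n) i ≡ 0#
  coeff-applyUpTo-≥ h {zero}  _         = ≡.refl
  coeff-applyUpTo-≥ h {suc n} (s≤s n≤i) = coeff-applyUpTo-≥ (h ∘ suc) n≤i

  -- For a literal degree the truncation is a literal list, on which eval and deriv compute.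
  ≈ₚ-truncation : ∀ f d → HasDegree f d → f ≈ₚ applyUpTo (coeff f) (suc d)
  ≈ₚ-truncation f d (_ , vanishes) i with i ≤? d
  ... | yes i≤d = reflexive (≡.sym (coeff-applyUpTo-< (coeff f) (s≤s i≤d)))
  ... | no  i≰d = trans (vanishes i (≰⇒> i≰d)) (reflexive (≡.sym (coeff-applyUpTo-≥ (coeff f) (≰⇒> i≰d))))

  root-of-deriv^ : ∀ f g j λ₀ m → f ≈ₚ g →
                   Multiplicity (deriv^ j f) λ₀ (suc m) → eval (deriv^ j g) λ₀ ≈ 0#
  root-of-deriv^ f g j λ₀ m f≈g mult =
    trans (sym (eval-cong (deriv^ j f) (deriv^ j g) λ₀ (deriv^-cong j f g f≈g)))
          (multiplicity-suc⇒root (deriv^ j f) λ₀ m mult)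

  -- The numeral n as a solver term; it evaluates definitionally to ι n.
  ιₜ : ∀ {k} → ℕ → Polynomial k
  ιₜ zero    = con 0
  ιₜ (suc n) = con 1 :+ ιₜ n

  -- Taylor expansion of the cubic g at a, with g''(a) eliminated via g''(a + d) = g''(a) + 6 c₃ d.
  cubic-taylor : ∀ a d c₀ c₁ c₂ c₃ → let g = c₀ ∷ c₁ ∷ c₂ ∷ c₃ ∷ [] in
    ι 4 * c₃ * (d * d * d) + ι 2 * eval g (a + d)
      ≈ ι 2 * eval g a + ι 2 * d * eval (deriv g) a + d * d * eval (deriv (deriv g)) (a + d)
  cubic-taylor = solve 6 (λ a d c₀ c₁ c₂ c₃ →
      let b = a :+ d in
      ιₜ 4 :* c₃ :* (d :* d :* d)
        :+ ιₜ 2 :* (c₀ :+ b :* (c₁ :+ b :* (c₂ :+ b :* (c₃ :+ b :* con 0))))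
      := ιₜ 2 :* (c₀ :+ a :* (c₁ :+ a :* (c₂ :+ a :* (c₃ :+ a :* con 0))))
        :+ ιₜ 2 :* d :* (ιₜ 1 :* c₁ :+ a :* (ιₜ 2 :* c₂ :+ a :* (ιₜ 3 :* c₃ :+ a :* con 0)))
        :+ d :* d :* (ιₜ 1 :* (ιₜ 2 :* c₂) :+ b :* (ιₜ 2 :* (ιₜ 3 :* c₃) :+ b :* con 0)))
    refl

  cubic-double-root-excludes-inflection-root :
    CharZero → ∀ {a b c₀ c₁ c₂ c₃} → let g = c₀ ∷ c₁ ∷ c₂ ∷ c₃ ∷ [] in
    ¬ (a ≈ b) → ¬ (c₃ ≈ 0#) →
    eval g a ≈ 0# → eval (deriv g) a ≈ 0# → eval g b ≈ 0# → eval (deriv (deriv g)) b ≈ 0# → ⊥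
  cubic-double-root-excludes-inflection-root charZero {a} {b} {c₀} {c₁} {c₂} {c₃}
    a≉b c₃≉0 ga≈0 g′a≈0 gb≈0 g″b≈0 = d³≉0 (x*y≈0⇒y≈0 (*-nonzero (charZero 3) c₃≉0) 4c₃d³≈0)
    where
    open import Relation.Binary.Reasoning.Setoid setoid
    g : Poly
    g = c₀ ∷ c₁ ∷ c₂ ∷ c₃ ∷ []

    d : Carrier
    d = - a + b

    a+d≈b : a + d ≈ b
    a+d≈b = \\-leftDividesˡ a b

    d≉0 : ¬ (d ≈ 0#)
    d≉0 d≈0 = a≉b (trans (sym (+-identityʳ a)) (trans (+-cong refl (sym d≈0)) a+d≈b))

    d³≉0 : ¬ (d * d * d ≈ 0#)
    d³≉0 = *-nonzero (*-nonzero d≉0 d≉0) d≉0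

    2g[a+d]≈0 : ι 2 * eval g (a + d) ≈ 0#
    2g[a+d]≈0 = trans (*-cong refl (trans (eval-congʳ g a+d≈b) gb≈0)) (zeroʳ (ι 2))

    4c₃d³≈0 : ι 4 * c₃ * (d * d * d) ≈ 0#
    4c₃d³≈0 = begin
      ι 4 * c₃ * (d * d * d)                          ≈⟨ +-identityʳ _ ⟨
      ι 4 * c₃ * (d * d * d) + 0#                     ≈⟨ +-cong refl 2g[a+d]≈0 ⟨
      ι 4 * c₃ * (d * d * d) + ι 2 * eval g (a + d)
        ≈⟨ cubic-taylor a d c₀ c₁ c₂ c₃ ⟩
      ι 2 * eval g a + ι 2 * d * eval (deriv g) a + d * d * eval (deriv (deriv g)) (a + d)
        ≈⟨ +-cong (+-cong (*-cong refl ga≈0) (*-cong refl g′a≈0))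
                  (*-cong refl (trans (eval-congʳ (deriv (deriv g)) a+d≈b) g″b≈0)) ⟩
      ι 2 * 0# + ι 2 * d * 0# + d * d * 0#
        ≈⟨ solve 2 (λ t d → t :* con 0 :+ t :* d :* con 0 :+ d :* d :* con 0 := con 0) refl (ι 2) d ⟩
      0# ∎

theorem8 : {c ℓ : Level} (K : Field c ℓ) → FieldTheory.CharZero K →
    ¬ (Σ (FieldTheory.Poly K) λ f → Σ (Fin 2 → Field.Carrier K) λ Λ →
    FieldTheory.Distinct K Λ × FieldTheory.IsMultMatrix K 3 f Λ M₈)
theorem8 K charZero (f , Λ , distinct , degree , mult) =
  cubic-double-root-excludes-inflection-root K charZero λ₁≉λ₂ (proj₁ degree)
    (root-at fz fz 1 (mult fz fz))
    (root-at fz (fs fz) 0 (mult fz (fs fz)))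
    (root-at (fs fz) fz 0 (mult (fs fz) fz))
    (root-at (fs fz) (fs (fs fz)) 0 (mult (fs fz) (fs (fs fz))))
  where
  open Field K using (_≈_; 0#)
  open FieldTheory K using (coeff; deriv^; eval; Multiplicity)

  f₃ : FieldTheory.Poly K
  f₃ = applyUpTo (coeff f) 4

  root-at : ∀ (i : Fin 2) (j : Fin 4) m →
            Multiplicity (deriv^ (toℕ j) f) (Λ i) (suc m) → eval (deriv^ (toℕ j) f₃) (Λ i) ≈ 0#
  root-at i j m = root-of-deriv^ K f f₃ (toℕ j) (Λ i) m (≈ₚ-truncation K f 3 degree)

  λ₁≉λ₂ : ¬ (Λ fz ≈ Λ (fs fz))
  λ₁≉λ₂ λ₁≈λ₂ with distinct fz (fs fz) λ₁≈λ₂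
  ... | ()
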